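{- Let $G$ be a 2-connected grid graph, $\phi\equiv2$, and $H,H'\in S_\phi$. Let $\tau$ be the unique real function on faces of $G$ with $\tau(f_0)=0$ on the unbounded face $f_0$ and $\sum_f\tau(f)\partial f=\omega_{H'}-\omega_H$. If $\tau(f)=0$ for every face $f\in B(H)$, then any two vertices lying on distinct cycles of $H$ lie on distinct cycles of $H'$.
   Context: A grid graph is a finite induced subgraph of $\mathbb{Z}^2$ embedded in the plane, with vertices colored black/white by parity of $x+y$. $S_\phi$ ($\phi\equiv2$) is the set of spanning subgraphs in which each vertex has degree 2 (partitions of the vertex set into disjoint cycles). $B(H)$ is the set of faces whose boundary contains vertices from at least two distinct cycles of $H$. $\omega_H$ is the 1-chain with $\omega_H(e)=1$ for $e\in H$ oriented black-to-white, $-1$ for the reverse orientation, $0$ for $e\notin H$; $\partial f$ is the sum of the boundary edges of $f$ oriented so that $f$ is on the right. -}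

module Defs where

open import Data.Bool using (Bool; true; false; if_then_else_; _∧_)
open import Data.Nat as ℕ using (ℕ; _%_; _≡ᵇ_)
open import Data.Integer as ℤ using (ℤ; +_; -_; ∣_∣)
open import Data.Product using (Σ; ∃; _×_; _,_)
open import Data.Sum using (_⊎_)
open import Relation.Binary.PropositionalEquality using (_≡_)
open import Relation.Binary.Construct.Closure.ReflexiveTransitive using (Star)
open import Relation.Nullary using (¬_)

Point : Set
Point = ℤ × ℤ

black : Point → Bool
black (x , y) = (∣ x ℤ.+ y ∣ % 2) ≡ᵇ 0

data Edge : Set where
  hor : ℤ → ℤ → Edge
  ver : ℤ → ℤ → Edge

src : Edge → Point
src (hor x y) = (x , y)
src (ver x y) = (x , y)

tgt : Edge → Point
tgt (hor x y) = (x ℤ.+ ℤ.1ℤ , y)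
tgt (ver x y) = (x , y ℤ.+ ℤ.1ℤ)

Joins : Edge → Point → Point → Set
Joins e p q = (src e ≡ p × tgt e ≡ q) ⊎ (src e ≡ q × tgt e ≡ p)

-- Grid graphs: finite induced subgraphs of ℤ², given by their vertex set.

record GridGraph : Set where
  field
    V      : Point → Bool
    finite : Σ ℕ λ N → ∀ x y → V (x , y) ≡ true → (∣ x ∣ ℕ.≤ N × ∣ y ∣ ℕ.≤ N)

open GridGraph public

Vtx : GridGraph → Point → Set
Vtx G p = V G p ≡ true

EdgeOf : GridGraph → Edge → Set
EdgeOf G e = (V G (src e) ∧ V G (tgt e)) ≡ true

AdjIn : GridGraph → (Point → Set) → Point → Point → Set
AdjIn G W p q = W p × W q × Σ Edge λ e → EdgeOf G e × Joins e p q

ConnectedOn : GridGraph → (Point → Set) → Set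
ConnectedOn G W = ∀ p q → W p → W q → Star (AdjIn G W) p q

TwoConnected : GridGraph → Set
TwoConnected G =
  (Σ Point λ a → Σ Point λ b → Σ Point λ c →
     Vtx G a × Vtx G b × Vtx G c × ¬ a ≡ b × ¬ a ≡ c × ¬ b ≡ c)
  × ConnectedOn G (Vtx G)
  × (∀ v → Vtx G v → ConnectedOn G (λ p → Vtx G p × ¬ p ≡ v))

b2ℕ : Bool → ℕ
b2ℕ true  = 1
b2ℕ false = 0

deg : (Edge → Bool) → Point → ℕ
deg H (x , y) =
  b2ℕ (H (hor x y)) ℕ.+ b2ℕ (H (hor (x ℤ.- ℤ.1ℤ) y))
  ℕ.+ b2ℕ (H (ver x y)) ℕ.+ b2ℕ (H (ver x (y ℤ.- ℤ.1ℤ)))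

InS2 : GridGraph → (Edge → Bool) → Set
InS2 G H = (∀ e → H e ≡ true → EdgeOf G e) × (∀ p → Vtx G p → deg H p ≡ 2)

-- p and q lie on the same cycle (= same connected component) of H
SameCycle : (Edge → Bool) → Point → Point → Set
SameCycle H = Star (λ p q → Σ Edge λ e → H e ≡ true × Joins e p q)

ω : (Edge → Bool) → Edge → ℤ
ω H e = if H e then (if black (src e) then ℤ.1ℤ else ℤ.-1ℤ) else ℤ.0ℤ

-- Unit cells of the plane: cell (x , y) = [x,x+1] × [y,y+1].
-- A face of the plane embedding of G is a maximal set of cells connected
-- through lattice edges not belonging to G (every face is such a union).

Cell : Set
Cell = ℤ × ℤ

CellStep : GridGraph → Cell → Cell → Set
CellStep G (x , y) d =
    (d ≡ (x ℤ.+ ℤ.1ℤ , y) × ¬ EdgeOf G (ver (x ℤ.+ ℤ.1ℤ) y))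
  ⊎ (d ≡ (x ℤ.- ℤ.1ℤ , y) × ¬ EdgeOf G (ver x y))
  ⊎ (d ≡ (x , y ℤ.+ ℤ.1ℤ) × ¬ EdgeOf G (hor x (y ℤ.+ ℤ.1ℤ)))
  ⊎ (d ≡ (x , y ℤ.- ℤ.1ℤ) × ¬ EdgeOf G (hor x y))

SameFace : GridGraph → Cell → Cell → Set
SameFace G = Star (CellStep G)

InUnboundedFace : GridGraph → Cell → Set
InUnboundedFace G c =
  ∀ (M : ℕ) → Σ Cell λ d → SameFace G c d × (M ℕ.< ∣ Data.Product.proj₁ d ∣)

Corner : Cell → Point → Set
Corner (x , y) p =
  (p ≡ (x , y)) ⊎ (p ≡ (x ℤ.+ ℤ.1ℤ , y)) ⊎ (p ≡ (x , y ℤ.+ ℤ.1ℤ))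
  ⊎ (p ≡ (x ℤ.+ ℤ.1ℤ , y ℤ.+ ℤ.1ℤ))

OnFaceBoundary : GridGraph → Cell → Point → Set
OnFaceBoundary G c p = Vtx G p × Σ Cell λ d → SameFace G c d × Corner d p

InB : GridGraph → (Edge → Bool) → Cell → Set
InB G H c = Σ Point λ p → Σ Point λ q →
  OnFaceBoundary G c p × OnFaceBoundary G c q × ¬ SameCycle H p q

-- ∂(cell) with the cell on the right (clockwise), as a 1-chain in the
-- standard orientation:  ∂(x,y) = ver x y + hor x (y+1) - ver (x+1) y - hor x y.
-- A face's boundary ∂f is the sum of ∂c over its cells (interior edges cancel),
-- so for τ constant on faces, (Σ_f τ(f) ∂f)(e) is the sum of τ(c)·∂c(e) over
-- the two cells c incident to e:
--   ver x y : cell (x , y) on its right (+1), cell (x-1 , y) on its left (-1)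
--   hor x y : cell (x , y-1) on its right (+1), cell (x , y) on its left (-1)
faceChain : (Cell → ℤ) → Edge → ℤ
faceChain τ (ver x y) = τ (x , y) ℤ.- τ (x ℤ.- ℤ.1ℤ , y)
faceChain τ (hor x y) = τ (x , y ℤ.- ℤ.1ℤ) ℤ.- τ (x , y)

FaceFunction : GridGraph → (Cell → ℤ) → Set
FaceFunction G τ = ∀ c d → SameFace G c d → τ c ≡ τ d

module Submission where

-- An edge e of H' whose endpoints lie on distinct cycles of H cannot be an edge of H,
-- so ω_{H'} − ω_H is ±1 on e. But the two cells on either side of e have both endpoints
-- of e as corners, so their faces lie in B(H) and τ vanishes on them; hence
-- (Σ τ(f) ∂f)(e) = 0, a contradiction. Thus every edge of H' stays inside a cycle of H,
-- and so does every path in H'.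

open import Defs
open import Level using (Level)
open import Algebra.Bundles using (AbelianGroup)
open import Data.Bool using (Bool; true; false; _∧_)
open import Data.Integer using (ℤ; _+_; _-_; 0ℤ; 1ℤ)
import Data.Integer.Properties as ℤ
open import Data.Product using (Σ; _×_; _,_; proj₁; proj₂)
open import Data.Sum using (inj₁; inj₂)
open import Relation.Binary.Core using (Rel)
open import Relation.Binary.PropositionalEquality using (_≡_; _≢_; refl; sym; cong; cong₂; module ≡-Reasoning)
open import Relation.Binary.Construct.Closure.ReflexiveTransitive using (Star; ε; _◅_; _◅◅_; reverse)
open import Relation.Nullary using (¬_)

-- In the additive group ℤ, //-rightDividesˡ 1ℤ x : x - 1ℤ + 1ℤ ≡ x.
open import Algebra.Properties.Group (AbelianGroup.group ℤ.+-0-abelianGroup)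
  using (//-rightDividesˡ)

∧≡true⁻ : ∀ {a b} → (a ∧ b) ≡ true → a ≡ true × b ≡ true
∧≡true⁻ {true} {true} _ = refl , refl

Star-map-¬¬ : ∀ {a r s : Level} {A : Set a} {R : Rel A r} {S : Rel A s} →
  (∀ {x y} → R x y → ¬ ¬ Star S x y) → ∀ {x y} → Star R x y → ¬ ¬ Star S x y
Star-map-¬¬ f ε         ¬s = ¬s ε
Star-map-¬¬ f (r ◅ rs) ¬s = f r λ s → Star-map-¬¬ f rs λ ss → ¬s (s ◅◅ ss)

rightCell leftCell : Edge → Cell
rightCell (ver x y) = x , y
rightCell (hor x y) = x , y - 1ℤ
leftCell  (ver x y) = x - 1ℤ , y
leftCell  (hor x y) = x , y

faceChain≡right-left : ∀ τ e → faceChain τ e ≡ τ (rightCell e) - τ (leftCell e)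
faceChain≡right-left τ (ver x y) = refl
faceChain≡right-left τ (hor x y) = refl

Corners : Cell → Edge → Set
Corners c e = Corner c (src e) × Corner c (tgt e)

rightCell-corners : ∀ e → Corners (rightCell e) e
rightCell-corners (ver x y) = inj₁ refl , inj₂ (inj₂ (inj₁ refl))
rightCell-corners (hor x y) =
  inj₂ (inj₂ (inj₁ (cong (x ,_) (sym (//-rightDividesˡ 1ℤ y))))) ,
  inj₂ (inj₂ (inj₂ (cong (x + 1ℤ ,_) (sym (//-rightDividesˡ 1ℤ y)))))

leftCell-corners : ∀ e → Corners (leftCell e) e
leftCell-corners (ver x y) =
  inj₂ (inj₁ (cong (_, y) (sym (//-rightDividesˡ 1ℤ x)))) ,
  inj₂ (inj₂ (inj₂ (cong (_, y + 1ℤ) (sym (//-rightDividesˡ 1ℤ x)))))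
leftCell-corners (hor x y) = inj₁ refl , inj₂ (inj₁ refl)

Corners-on-distinct-cycles⇒InB : ∀ G {H c e} → Vtx G (src e) → Vtx G (tgt e) →
  ¬ SameCycle H (src e) (tgt e) → Corners c e → InB G H c
Corners-on-distinct-cycles⇒InB G {c = c} vs vt ¬same (cs , ct) =
  _ , _ , (vs , c , ε , cs) , (vt , c , ε , ct) , ¬same

ω-new-edge-nonzero : ∀ H H' e → H e ≡ false → H' e ≡ true → ω H' e - ω H e ≢ 0ℤ
ω-new-edge-nonzero H H' e He Hʹe
  rewrite He | Hʹe with black (src e)
... | true  = λ ()
... | false = λ ()

module _ (G : GridGraph) {H H' : Edge → Bool} {τ : Cell → ℤ}
    (H'⊆G : ∀ e → H' e ≡ true → EdgeOf G e)
    (boundary : ∀ e → faceChain τ e ≡ ω H' e - ω H e)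
    (τ-vanishes-on-B : ∀ c → InB G H c → τ c ≡ 0ℤ) where

  faceChain-vanishes-across-cycles : ∀ e → Vtx G (src e) → Vtx G (tgt e) →
    ¬ SameCycle H (src e) (tgt e) → faceChain τ e ≡ 0ℤ
  faceChain-vanishes-across-cycles e vs vt ¬same = begin
    faceChain τ e                      ≡⟨ faceChain≡right-left τ e ⟩
    τ (rightCell e) - τ (leftCell e)   ≡⟨ cong₂ _-_ (τ-zero (rightCell-corners e))
                                                     (τ-zero (leftCell-corners e)) ⟩
    0ℤ                                 ∎
    where
    open ≡-Reasoning
    τ-zero : ∀ {c} → Corners c e → τ c ≡ 0ℤ
    τ-zero cs = τ-vanishes-on-B _ (Corners-on-distinct-cycles⇒InB G vs vt ¬same cs)

  H'-edge-within-H-cycle : ∀ e → H' e ≡ true → ¬ ¬ SameCycle H (src e) (tgt e)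
  H'-edge-within-H-cycle e Hʹe ¬same with H e in He
  ... | true  = ¬same ((e , He , inj₁ (refl , refl)) ◅ ε)
  ... | false = ω-new-edge-nonzero H H' e He Hʹe (begin
    ω H' e - ω H e   ≡⟨ sym (boundary e) ⟩
    faceChain τ e    ≡⟨ faceChain-vanishes-across-cycles e vs vt ¬same ⟩
    0ℤ               ∎)
    where
    open ≡-Reasoning
    vs : Vtx G (src e)
    vs = proj₁ (∧≡true⁻ (H'⊆G e Hʹe))
    vt : Vtx G (tgt e)
    vt = proj₂ (∧≡true⁻ (H'⊆G e Hʹe))

  SameCycle-H'⇒¬¬SameCycle-H : ∀ {u v} → SameCycle H' u v → ¬ ¬ SameCycle H u v
  SameCycle-H'⇒¬¬SameCycle-H = Star-map-¬¬ step
    where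
    step : ∀ {p q} → (Σ Edge λ e → H' e ≡ true × Joins e p q) → ¬ ¬ SameCycle H p q
    step (e , Hʹe , inj₁ (refl , refl)) = H'-edge-within-H-cycle e Hʹe
    step (e , Hʹe , inj₂ (refl , refl)) ¬same =
      H'-edge-within-H-cycle e Hʹe λ s → ¬same (reverse swapEnds s)
      where
      swapEnds : ∀ {p q} → (Σ Edge λ e → H e ≡ true × Joins e p q) → Σ Edge λ e → H e ≡ true × Joins e q p
      swapEnds (d , Hd , inj₁ j) = d , Hd , inj₂ j
      swapEnds (d , Hd , inj₂ j) = d , Hd , inj₁ j

mainTheorem4 : (G : GridGraph) → TwoConnected G →
    (H H' : Edge → Bool) → InS2 G H → InS2 G H' →
    (τ : Cell → ℤ) → FaceFunction G τ →
    (∀ c → InUnboundedFace G c → τ c ≡ 0ℤ) →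
    (∀ e → faceChain τ e ≡ ω H' e - ω H e) →
    (∀ c → InB G H c → τ c ≡ 0ℤ) →
    ∀ u v → Vtx G u → Vtx G v → ¬ SameCycle H u v → ¬ SameCycle H' u v
mainTheorem4 G _ H H' _ (H'⊆G , _) τ _ _ boundary τ-vanishes-on-B u v _ _ ¬sameH sameH' =
  SameCycle-H'⇒¬¬SameCycle-H G H'⊆G boundary τ-vanishes-on-B sameH' ¬sameH
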